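{- For every $n\ge2$, \[\max_{\pi\in S_n}|\operatorname{SC}_{213}^{ -1}(\pi)|=\max_{\pi\in S_n}|\operatorname{SC}_{231}^{ -1}(\pi)|=2^{n-2}.\]
   Context: $S_n$ is the set of permutations of $[n]$ in one-line notation. Two sequences of distinct integers have the same relative order if replacing the $i$th smallest entry of each by $i$ yields the same word; a sequence avoids $\sigma$ consecutively if no consecutive subsequence has the same relative order as $\sigma$. For $\sigma\in\{213,231\}$, $\operatorname{SC}_\sigma:S_n\to S_n$ sends a permutation through a stack: at each step, if there is a next input entry and placing it on top of the stack would make the stack contents, read top to bottom, avoid $\sigma$ consecutively, push it; otherwise pop the top entry of the stack to the end of the output; stop when the output has length $n$. -}

module Defs where

open import Data.Nat using (ℕ; zero; suc; _+_; _*_; _<ᵇ_)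
open import Data.Bool using (Bool; true; false; _∧_; not; if_then_else_)
open import Data.Bool.Properties using () renaming (_≟_ to _≟ᵇ_)
open import Data.List using (List; []; _∷_; length; map; upTo; take; _++_; [_])
open import Data.Product using (Σ; _×_)
open import Relation.Binary.PropositionalEquality using (_≡_)
open import Relation.Binary.Core using (Rel)
open import Data.List.Relation.Binary.Permutation.Propositional using (_↭_)
open import Data.List.Relation.Unary.Unique.Propositional using (Unique)
open import Data.List.Membership.Propositional using (_∈_)
open import Function.Bundles using (_⇔_)

range : ℕ → List ℕ
range n = map suc (upTo n)

-- S_n: permutations of [n] in one-line notation (as lists)
IsPerm : ℕ → List ℕ → Set
IsPerm n π = π ↭ range n

_==_ : Bool → Bool → Bool
true  == b = b
false == b = not b

headAgree : ℕ → List ℕ → ℕ → List ℕ → Bool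
headAgree x (x' ∷ xs) y (y' ∷ ys) =
  ((x <ᵇ x') == (y <ᵇ y')) ∧ ((x' <ᵇ x) == (y' <ᵇ y)) ∧ headAgree x xs y ys
headAgree x [] y [] = true
headAgree _ _ _ _ = false

-- two sequences of distinct integers have the same relative order
-- (equivalently: equal length and every pair of positions is compared
-- the same way in both)
sameOrder : List ℕ → List ℕ → Bool
sameOrder [] [] = true
sameOrder (x ∷ xs) (y ∷ ys) = headAgree x xs y ys ∧ sameOrder xs ys
sameOrder _ _ = false

containsConsec : List ℕ → List ℕ → Bool
containsConsec σ [] = sameOrder (take (length σ) []) σ
containsConsec σ (x ∷ xs) =
  sameOrder (take (length σ) (x ∷ xs)) σ ∨' containsConsec σ xs
  where
  _∨'_ : Bool → Bool → Bool
  true ∨' _ = true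
  false ∨' b = b

avoidsConsec : List ℕ → List ℕ → Bool
avoidsConsec σ w = not (containsConsec σ w)

-- The stack machine.  State: remaining input, stack (head = top),
-- output so far.  Fuel bounds the number of steps (2n suffices, since
-- each step pushes or pops one of the n entries).
scRun : ℕ → List ℕ → List ℕ → List ℕ → List ℕ → List ℕ
scRun zero σ inp stk out = out
scRun (suc f) σ [] [] out = out
scRun (suc f) σ (x ∷ inp) stk out =
  if avoidsConsec σ (x ∷ stk)
  then scRun f σ inp (x ∷ stk) out
  else pop stk
  where
  pop : List ℕ → List ℕ
  pop [] = out
  pop (t ∷ s) = scRun f σ (x ∷ inp) s (out ++ [ t ])
scRun (suc f) σ [] (t ∷ s) out = scRun f σ [] s (out ++ [ t ])

SC : List ℕ → List ℕ → List ℕ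
SC σ π = scRun (2 * length π + 1) σ π [] []

HasCard : (List ℕ → Set) → ℕ → Set
HasCard P k = Σ (List (List ℕ)) λ L → Unique L × (∀ w → (w ∈ L) ⇔ P w) × length L ≡ k

Fibre : List ℕ → ℕ → List ℕ → List ℕ → Set
Fibre σ n π τ = IsPerm n τ × SC σ τ ≡ π

-- For σ ∈ {213, 231}, an entry that cannot be pushed can always be pushed after a single pop. A run
-- of SC_σ is therefore recorded by one bit per input entry (pushed directly or after one pop), the
-- first two bits being forced pushes, and the input is recovered from this bit string together with
-- the output; hence every fibre has at most 2^(n-2) elements. The bound is attained by the identity
-- for 213 and by n⋯21 for 231: their preimages are n (resp. 1) followed by an arrangement of the
-- remaining values in which every entry is the least or the greatest value not yet used.
module Submission where

open import Defs
open import Data.Bool using (Bool; true; false; not; _∧_; if_then_else_)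
open import Data.Bool.Properties using (∧-zeroʳ; not-injective; not-involutive; T-≡)
open import Data.Empty using (⊥)
open import Data.List using (List; []; _∷_; length; map; upTo; applyUpTo; take; drop; _++_; [_]; removeAt)
open import Data.List.Properties
  using ( ∷-injective; ∷-injectiveʳ; ++-assoc; ++-identityʳ; length-map; length-++; length-upTo; length-removeAt′
        ; map-upTo; take-all)
open import Data.List.Membership.Propositional using (_∈_)
open import Data.List.Membership.Propositional.Properties using (∈-map⁺; ∈-map⁻; ∈-++⁺ˡ; ∈-++⁺ʳ; ∈-++⁻)
open import Data.List.Relation.Unary.All as All using ([])
open import Data.List.Relation.Unary.AllPairs using ([]; _∷_)
open import Data.List.Relation.Unary.Any using (here; there; index)
open import Data.List.Relation.Unary.Unique.Propositional using (Unique)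
import Data.List.Relation.Unary.Unique.Propositional.Properties as Unique
open import Data.List.Relation.Binary.Permutation.Propositional using (_↭_; ↭-refl; ↭-trans; ↭-prep; ↭-reflexive)
open import Data.List.Relation.Binary.Permutation.Propositional.Properties using (∷↭∷ʳ; ↭-length)
open import Data.Nat using (ℕ; zero; suc; _+_; _*_; _^_; _∸_; _<ᵇ_; _≤_; _<_; z≤n; s≤s)
open import Data.Nat.Properties
open import Data.Product using (Σ; _×_; _,_; proj₁; proj₂)
open import Data.Sum using (_⊎_; inj₁; inj₂)
open import Function.Bundles using (Equivalence; mk⇔)
open import Relation.Binary.PropositionalEquality hiding ([_])
open import Relation.Nullary using (contradiction)

private
  variable
    σ w stk inp s R : List ℕ
    x y z t lo k : ℕ

occursAtHead : List ℕ → List ℕ → Bool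
occursAtHead σ w = sameOrder (take (length σ) w) σ

headAgree-≢length : ∀ x xs y ys → length xs ≢ length ys → headAgree x xs y ys ≡ false
headAgree-≢length x [] y [] ≢ = contradiction refl ≢
headAgree-≢length x [] y (_ ∷ _) _ = refl
headAgree-≢length x (_ ∷ _) y [] _ = refl
headAgree-≢length x (x′ ∷ xs) y (y′ ∷ ys) ≢
  rewrite headAgree-≢length x xs y ys (λ e → ≢ (cong suc e)) =
    trans (cong (((x <ᵇ x′) == (y <ᵇ y′)) ∧_) (∧-zeroʳ _)) (∧-zeroʳ _)

sameOrder-≢length : ∀ u v → length u ≢ length v → sameOrder u v ≡ false
sameOrder-≢length [] [] ≢ = contradiction refl ≢
sameOrder-≢length [] (_ ∷ _) _ = refl
sameOrder-≢length (_ ∷ _) [] _ = refl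
sameOrder-≢length (x ∷ u) (y ∷ v) ≢
  rewrite sameOrder-≢length u v (λ e → ≢ (cong suc e)) = ∧-zeroʳ _

module _ (σ : List ℕ) where

  occursAtHead-short : length w < length σ → occursAtHead σ w ≡ false
  occursAtHead-short {w} w<σ =
    trans (cong (λ u → sameOrder u σ) (take-all (length σ) w (<⇒≤ w<σ))) (sameOrder-≢length w σ (<⇒≢ w<σ))

  containsConsec-∷⁺ : occursAtHead σ (x ∷ w) ≡ false → containsConsec σ w ≡ false →
    containsConsec σ (x ∷ w) ≡ false
  containsConsec-∷⁺ {x} {w} here-free rest-free with occursAtHead σ (x ∷ w)
  ... | false = rest-free

  containsConsec-∷⁻ : containsConsec σ (x ∷ w) ≡ false →
    occursAtHead σ (x ∷ w) ≡ false × containsConsec σ w ≡ false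
  containsConsec-∷⁻ {x} {w} free with occursAtHead σ (x ∷ w)
  ... | false = refl , free

  occursAtHead⇒containsConsec : occursAtHead σ (x ∷ w) ≡ true → containsConsec σ (x ∷ w) ≡ true
  occursAtHead⇒containsConsec {x} {w} occurs with occursAtHead σ (x ∷ w)
  ... | true = refl

  containsConsec⇒occursAtHead : containsConsec σ (x ∷ w) ≡ true → containsConsec σ w ≡ false →
    occursAtHead σ (x ∷ w) ≡ true
  containsConsec⇒occursAtHead {x} {w} contains rest-free with occursAtHead σ (x ∷ w)
  ... | true = refl
  ... | false = trans (sym rest-free) contains

  containsConsec-short : length w < length σ → containsConsec σ w ≡ false
  containsConsec-short {[]} w<σ = occursAtHead-short w<σ
  containsConsec-short {x ∷ w} w<σ =
    containsConsec-∷⁺ (occursAtHead-short w<σ) (containsConsec-short {w} (<-trans (n<1+n _) w<σ))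

-- A run of the stack machine in which every input entry is pushed either directly (false) or
-- right after a single pop (true) is determined by this bit string: `replay` rebuilds its output.
trace : List ℕ → List ℕ → List ℕ → List Bool
trace σ [] stk = []
trace σ (x ∷ inp) stk =
  if avoidsConsec σ (x ∷ stk)
  then false ∷ trace σ inp (x ∷ stk)
  else true ∷ trace σ inp (x ∷ drop 1 stk)

replay : List Bool → List ℕ → List ℕ → List ℕ
replay (false ∷ bs) (x ∷ inp) stk = replay bs inp (x ∷ stk)
replay (true ∷ bs) (x ∷ inp) [] = replay bs inp [ x ]
replay (true ∷ bs) (x ∷ inp) (t ∷ s) = t ∷ replay bs inp (x ∷ s)
replay _ _ stk = stk

-- Under this hypothesis no input entry causes more than one pop.
SinglePop : List ℕ → Set
SinglePop σ = ∀ x t s → occursAtHead σ (x ∷ t ∷ s) ≡ true → occursAtHead σ (x ∷ s) ≡ false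

record Admissible (σ : List ℕ) : Set where
  field
    singlePop : SinglePop σ
    longerThanTwo : 2 < length σ

open Admissible

short-avoids : Admissible σ → length w ≤ 2 → containsConsec σ w ≡ false
short-avoids {σ} {w} adm w≤2 = containsConsec-short σ {w} (≤-<-trans w≤2 (longerThanTwo adm))

pushable-after-pop : SinglePop σ → avoidsConsec σ (x ∷ t ∷ s) ≡ false → containsConsec σ (t ∷ s) ≡ false →
  avoidsConsec σ (x ∷ s) ≡ true
pushable-after-pop {σ} {x} {t} {s} single blocked stack-free =
  cong not (containsConsec-∷⁺ σ (single x t s occurs) (proj₂ (containsConsec-∷⁻ σ stack-free)))
  where
  occurs : occursAtHead σ (x ∷ t ∷ s) ≡ true
  occurs = containsConsec⇒occursAtHead σ (not-injective {y = true} blocked) stack-free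

trace-push : avoidsConsec σ (x ∷ stk) ≡ true → trace σ (x ∷ inp) stk ≡ false ∷ trace σ inp (x ∷ stk)
trace-push pushable rewrite pushable = refl

trace-pop : avoidsConsec σ (x ∷ t ∷ s) ≡ false → trace σ (x ∷ inp) (t ∷ s) ≡ true ∷ trace σ inp (x ∷ s)
trace-pop blocked rewrite blocked = refl

length-trace : ∀ inp stk → length (trace σ inp stk) ≡ length inp
length-trace [] stk = refl
length-trace {σ} (x ∷ inp) stk with avoidsConsec σ (x ∷ stk)
... | true = cong suc (length-trace inp (x ∷ stk))
... | false = cong suc (length-trace inp (x ∷ drop 1 stk))

scRun-flush : ∀ f stk out → length stk ≤ f → scRun f σ [] stk out ≡ out ++ stk
scRun-flush zero [] out _ = sym (++-identityʳ out)
scRun-flush (suc f) [] out _ = sym (++-identityʳ out)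
scRun-flush (suc f) (t ∷ s) out (s≤s s≤f) = trans (scRun-flush f s (out ++ [ t ]) s≤f) (++-assoc out [ t ] s)

-- Writing the fuel bound with `length inp * 2` lets it shrink by two `suc`s per input entry.
scRun-replay : Admissible σ → ∀ f inp stk out → containsConsec σ stk ≡ false →
  length inp * 2 + length stk ≤ f →
  scRun f σ inp stk out ≡ out ++ replay (trace σ inp stk) inp stk
scRun-replay adm f [] stk out _ fuel = scRun-flush f stk out fuel
scRun-replay {σ} adm (suc f) (x ∷ inp) [] out _ (s≤s fuel) with avoidsConsec σ [ x ] in pushable
... | true = scRun-replay adm f inp [ x ] out (not-injective pushable) (subst (_≤ f) (sym (+-suc _ 0)) fuel)
... | false = contradiction (trans (sym pushable) (cong not (short-avoids {σ} {[ x ]} adm (s≤s z≤n)))) λ ()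
scRun-replay {σ} adm (suc (suc f)) (x ∷ inp) (t ∷ s) out stack-free (s≤s (s≤s fuel′))
  with avoidsConsec σ (x ∷ t ∷ s) in pushable
... | true = scRun-replay adm (suc f) inp (x ∷ t ∷ s) out (not-injective pushable)
  (subst (_≤ suc f) (sym (+-suc _ _)) (s≤s fuel′))
... | false with avoidsConsec σ (x ∷ s) in pushable′
...   | true = trans (scRun-replay adm f inp (x ∷ s) (out ++ [ t ]) (not-injective pushable′) fuel′)
  (++-assoc out [ t ] _)
...   | false = contradiction
  (trans (sym pushable′) (pushable-after-pop {σ} {x} {t} {s} (singlePop adm) pushable stack-free)) λ ()

SC-replay : Admissible σ → ∀ τ → SC σ τ ≡ replay (trace σ τ []) τ []
SC-replay {σ} adm τ = scRun-replay adm (2 * length τ + 1) τ [] [] (short-avoids {σ} {[]} adm z≤n) fuel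
  where
  fuel : length τ * 2 + 0 ≤ 2 * length τ + 1
  fuel = ≤-trans (≤-reflexive (trans (+-identityʳ _) (*-comm (length τ) 2))) (m≤m+n _ 1)

trace-two-pushes : Admissible σ → ∀ a c inp → trace σ (a ∷ c ∷ inp) [] ≡ false ∷ false ∷ trace σ inp (c ∷ a ∷ [])
trace-two-pushes {σ} adm a c inp
  rewrite cong not (short-avoids {σ} {[ a ]} adm (s≤s z≤n))
        | cong not (short-avoids {σ} {c ∷ a ∷ []} adm (s≤s (s≤s z≤n))) = refl

replay-injective : ∀ bs {i i′ s s′} → length i ≡ length bs → length i′ ≡ length bs → length s ≡ length s′ →
  replay bs i s ≡ replay bs i′ s′ → i ≡ i′ × s ≡ s′
replay-injective [] {[]} {[]} _ _ _ same = refl , same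
replay-injective (false ∷ bs) {x ∷ i} {x′ ∷ i′} ∣i∣ ∣i′∣ ∣s∣ same
  with refl , refl ← replay-injective bs (suc-injective ∣i∣) (suc-injective ∣i′∣) (cong suc ∣s∣) same = refl , refl
replay-injective (true ∷ bs) {x ∷ i} {x′ ∷ i′} {[]} {[]} ∣i∣ ∣i′∣ _ same
  with refl , refl ← replay-injective bs (suc-injective ∣i∣) (suc-injective ∣i′∣) refl same = refl , refl
replay-injective (true ∷ bs) {x ∷ i} {x′ ∷ i′} {t ∷ s} {t′ ∷ s′} ∣i∣ ∣i′∣ ∣s∣ same
  with refl , same′ ← ∷-injective same
  with refl , refl ← replay-injective bs (suc-injective ∣i∣) (suc-injective ∣i′∣) ∣s∣ same′ = refl , refl

trace-SC-injective : Admissible σ → ∀ {τ τ′} → length τ ≡ length τ′ →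
  trace σ τ [] ≡ trace σ τ′ [] → SC σ τ ≡ SC σ τ′ → τ ≡ τ′
trace-SC-injective {σ} adm {τ} {τ′} ∣τ∣ same-trace same-output =
  proj₁ (replay-injective bs (sym (length-trace τ [])) (trans (sym ∣τ∣) (sym (length-trace τ [])))
    refl same-replay)
  where
  open ≡-Reasoning
  bs : List Bool
  bs = trace σ τ []
  same-replay : replay bs τ [] ≡ replay bs τ′ []
  same-replay = begin
    replay bs τ [] ≡⟨ SC-replay adm τ ⟨
    SC σ τ ≡⟨ same-output ⟩
    SC σ τ′ ≡⟨ SC-replay adm τ′ ⟩
    replay (trace σ τ′ []) τ′ [] ≡⟨ cong (λ bs′ → replay bs′ τ′ []) same-trace ⟨
    replay bs τ′ [] ∎

∈-removeAt : ∀ {A : Set} {x z : A} {ys} (x∈ys : x ∈ ys) → z ∈ ys → z ≢ x → z ∈ removeAt ys (index x∈ys)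
∈-removeAt (here refl) (here refl) z≢x = contradiction refl z≢x
∈-removeAt (here refl) (there z∈ys) _ = z∈ys
∈-removeAt (there x∈ys) (here refl) _ = here refl
∈-removeAt (there x∈ys) (there z∈ys) z≢x = there (∈-removeAt x∈ys z∈ys z≢x)

length-≤-injectiveOn : ∀ {A B : Set} (f : A → B) {xs ys} → Unique xs → (∀ {x} → x ∈ xs → f x ∈ ys) →
  (∀ {x x′} → x ∈ xs → x′ ∈ xs → f x ≡ f x′ → x ≡ x′) → length xs ≤ length ys
length-≤-injectiveOn f {[]} _ _ _ = z≤n
length-≤-injectiveOn f {x ∷ xs} {ys} (x∉xs ∷ unique) into injective =
  ≤-trans (s≤s (length-≤-injectiveOn f unique into′ injective′)) (≤-reflexive (sym (length-removeAt′ ys _)))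
  where
  fx∈ys : f x ∈ ys
  fx∈ys = into (here refl)
  into′ : ∀ {x′} → x′ ∈ xs → f x′ ∈ removeAt ys (index fx∈ys)
  into′ x′∈xs = ∈-removeAt fx∈ys (into (there x′∈xs))
    (λ same → All.lookup x∉xs x′∈xs (sym (injective (there x′∈xs) (here refl) same)))
  injective′ : ∀ {x₁ x₂} → x₁ ∈ xs → x₂ ∈ xs → f x₁ ≡ f x₂ → x₁ ≡ x₂
  injective′ x₁∈xs x₂∈xs = injective (there x₁∈xs) (there x₂∈xs)

bitStrings : ℕ → List (List Bool)
bitStrings zero = [ [] ]
bitStrings (suc k) = map (true ∷_) (bitStrings k) ++ map (false ∷_) (bitStrings k)

length-bitStrings : ∀ k → length (bitStrings k) ≡ 2 ^ k
length-bitStrings zero = refl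
length-bitStrings (suc k) = begin
  length (map (true ∷_) B ++ map (false ∷_) B)          ≡⟨ length-++ (map (true ∷_) B) ⟩
  length (map (true ∷_) B) + length (map (false ∷_) B) ≡⟨ cong₂ _+_ (length-map (true ∷_) B) (length-map (false ∷_) B) ⟩
  length B + length B                                   ≡⟨ cong (λ m → m + m) (length-bitStrings k) ⟩
  2 ^ k + 2 ^ k                                         ≡⟨ cong (2 ^ k +_) (+-identityʳ (2 ^ k)) ⟨
  2 ^ suc k                                             ∎
  where
  open ≡-Reasoning
  B : List (List Bool)
  B = bitStrings k

∈-bitStrings⁺ : ∀ {b k} → length b ≡ k → b ∈ bitStrings k
∈-bitStrings⁺ {[]} refl = here refl
∈-bitStrings⁺ {true ∷ b} refl = ∈-++⁺ˡ (∈-map⁺ (true ∷_) (∈-bitStrings⁺ refl))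
∈-bitStrings⁺ {false ∷ b} refl = ∈-++⁺ʳ (map (true ∷_) (bitStrings (length b))) (∈-map⁺ (false ∷_) (∈-bitStrings⁺ refl))

∈-bitStrings⁻ : ∀ {b} k → b ∈ bitStrings k → length b ≡ k
∈-bitStrings⁻ zero (here refl) = refl
∈-bitStrings⁻ (suc k) b∈ with ∈-++⁻ (map (true ∷_) (bitStrings k)) b∈
... | inj₁ b∈₁ with _ , b′∈ , refl ← ∈-map⁻ (true ∷_) b∈₁ = cong suc (∈-bitStrings⁻ k b′∈)
... | inj₂ b∈₂ with _ , b′∈ , refl ← ∈-map⁻ (false ∷_) b∈₂ = cong suc (∈-bitStrings⁻ k b′∈)

bitStrings-unique : ∀ k → Unique (bitStrings k)
bitStrings-unique zero = [] ∷ []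
bitStrings-unique (suc k) =
  Unique.++⁺ (Unique.map⁺ ∷-injectiveʳ (bitStrings-unique k)) (Unique.map⁺ ∷-injectiveʳ (bitStrings-unique k)) disjoint
  where
  disjoint : ∀ {b} → b ∈ map (true ∷_) (bitStrings k) × b ∈ map (false ∷_) (bitStrings k) → ⊥
  disjoint (b∈₁ , b∈₂) with _ , _ , refl ← ∈-map⁻ (true ∷_) b∈₁ | _ , _ , () ← ∈-map⁻ (false ∷_) b∈₂

length-range : ∀ n → length (range n) ≡ n
length-range n = trans (length-map suc (upTo n)) (length-upTo n)

length-perm : ∀ {n τ} → IsPerm n τ → length τ ≡ n
length-perm {n} τ↭ = trans (↭-length τ↭) (length-range n)

pushPush : List Bool → List Bool
pushPush b = false ∷ false ∷ b

trace∈pushPush : Admissible σ → ∀ τ → length τ ≡ 2 + k → trace σ τ [] ∈ map pushPush (bitStrings k)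
trace∈pushPush {σ} adm (a ∷ c ∷ inp) ∣τ∣ rewrite trace-two-pushes adm a c inp =
  ∈-map⁺ pushPush (∈-bitStrings⁺ (trans (length-trace inp (c ∷ a ∷ [])) (suc-injective (suc-injective ∣τ∣))))

fibre-card-≤ : Admissible σ → ∀ k π m → HasCard (Fibre σ (2 + k) π) m → m ≤ 2 ^ k
fibre-card-≤ {σ} adm k π _ (L , unique , members , refl) =
  ≤-trans (length-≤-injectiveOn (λ τ → trace σ τ []) unique into injective) (≤-reflexive traces)
  where
  fibre : ∀ {τ} → τ ∈ L → Fibre σ (2 + k) π τ
  fibre = Equivalence.to (members _)
  into : ∀ {τ} → τ ∈ L → trace σ τ [] ∈ map pushPush (bitStrings k)
  into {τ} τ∈L = trace∈pushPush adm τ (length-perm (proj₁ (fibre τ∈L)))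
  injective : ∀ {τ τ′} → τ ∈ L → τ′ ∈ L → trace σ τ [] ≡ trace σ τ′ [] → τ ≡ τ′
  injective τ∈L τ′∈L same-trace =
    trace-SC-injective adm (trans (length-perm (proj₁ (fibre τ∈L))) (sym (length-perm (proj₁ (fibre τ′∈L)))))
      same-trace (trans (proj₂ (fibre τ∈L)) (sym (proj₂ (fibre τ′∈L))))
  traces : length (map pushPush (bitStrings k)) ≡ 2 ^ k
  traces = trans (length-map pushPush (bitStrings k)) (length-bitStrings k)

fibre-card-of-preimages : Admissible σ → ∀ {k π} (preimage : List Bool → List ℕ) →
  (∀ b → trace σ (preimage b) [] ≡ pushPush b) →
  (∀ b → length b ≡ k → Fibre σ (2 + k) π (preimage b)) →
  HasCard (Fibre σ (2 + k) π) (2 ^ k)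
fibre-card-of-preimages {σ} adm {k} {π} preimage traced in-fibre =
  map preimage (bitStrings k) ,
  Unique.map⁺ preimage-injective (bitStrings-unique k) ,
  (λ τ → mk⇔ sound complete) ,
  trans (length-map preimage (bitStrings k)) (length-bitStrings k)
  where
  preimage-injective : ∀ {b b′} → preimage b ≡ preimage b′ → b ≡ b′
  preimage-injective {b} {b′} same =
    ∷-injectiveʳ (∷-injectiveʳ (trans (sym (traced b)) (trans (cong (λ τ → trace σ τ []) same) (traced b′))))
  sound : ∀ {τ} → τ ∈ map preimage (bitStrings k) → Fibre σ (2 + k) π τ
  sound τ∈ with b , b∈ , refl ← ∈-map⁻ preimage τ∈ = in-fibre b (∈-bitStrings⁻ k b∈)
  complete : ∀ {τ} → Fibre σ (2 + k) π τ → τ ∈ map preimage (bitStrings k)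
  complete {τ} (τ↭ , output) with b , b∈ , same-trace ← ∈-map⁻ pushPush (trace∈pushPush adm τ (length-perm τ↭)) =
    subst (_∈ map preimage (bitStrings k)) (sym τ≡) (∈-map⁺ preimage b∈)
    where
    b-fibre : Fibre σ (2 + k) π (preimage b)
    b-fibre = in-fibre b (∈-bitStrings⁻ k b∈)
    τ≡ : τ ≡ preimage b
    τ≡ = trace-SC-injective adm (trans (length-perm τ↭) (sym (length-perm (proj₁ b-fibre))))
      (trans same-trace (sym (traced b))) (trans output (sym (proj₂ b-fibre)))

<ᵇ-true : ∀ {m n} → m < n → (m <ᵇ n) ≡ true
<ᵇ-true m<n = Equivalence.to T-≡ (<⇒<ᵇ m<n)

<ᵇ-true⁻ : ∀ {m n} → (m <ᵇ n) ≡ true → m < n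
<ᵇ-true⁻ {m} {n} m<ᵇn = <ᵇ⇒< m n (Equivalence.from T-≡ m<ᵇn)

<ᵇ-false : ∀ {m n} → n < m → (m <ᵇ n) ≡ false
<ᵇ-false {m} {n} n<m with m <ᵇ n in m<ᵇn
... | false = refl
... | true = contradiction (<ᵇ-true⁻ m<ᵇn) (<-asym n<m)

-- Opaque, so that unification does not unfold containsConsec on these concrete patterns.
opaque
  σ213 σ231 : List ℕ
  σ213 = 2 ∷ 1 ∷ 3 ∷ []
  σ231 = 2 ∷ 3 ∷ 1 ∷ []

opaque
  unfolding σ213 σ231

  σ213-def : σ213 ≡ 2 ∷ 1 ∷ 3 ∷ []
  σ213-def = refl

  σ231-def : σ231 ≡ 2 ∷ 3 ∷ 1 ∷ []
  σ231-def = refl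

  occursAtHead-213 : y < x → x < z → occursAtHead σ213 (x ∷ y ∷ z ∷ R) ≡ true
  occursAtHead-213 {y} {x} {z} y<x x<z
    rewrite <ᵇ-false {x} {y} y<x | <ᵇ-true y<x | <ᵇ-true x<z | <ᵇ-false {z} {x} x<z
          | <ᵇ-true (<-trans y<x x<z) | <ᵇ-false {z} {y} (<-trans y<x x<z) = refl

  occursAtHead-213⁻ : occursAtHead σ213 (x ∷ y ∷ z ∷ R) ≡ true → x < z
  occursAtHead-213⁻ {x} {y} {z} occurs with x <ᵇ y | y <ᵇ x | x <ᵇ z in x<ᵇz
  ... | _ | _ | true = <ᵇ-true⁻ x<ᵇz
  ... | true | _ | false = contradiction occurs λ ()
  ... | false | false | false = contradiction occurs λ ()
  ... | false | true | false = contradiction occurs λ ()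

  ¬occursAtHead-213 : x < z → occursAtHead σ213 (x ∷ z ∷ R) ≡ false
  ¬occursAtHead-213 {x} {z} {[]} _ = occursAtHead-short σ213 {x ∷ z ∷ []} ≤-refl
  ¬occursAtHead-213 {R = _ ∷ _} x<z rewrite <ᵇ-true x<z = refl

  occursAtHead-231 : z < x → x < y → occursAtHead σ231 (x ∷ y ∷ z ∷ R) ≡ true
  occursAtHead-231 {z} {x} {y} z<x x<y
    rewrite <ᵇ-true x<y | <ᵇ-false {y} {x} x<y | <ᵇ-false {x} {z} z<x | <ᵇ-true z<x
          | <ᵇ-false {y} {z} (<-trans z<x x<y) | <ᵇ-true (<-trans z<x x<y) = refl

  occursAtHead-231⁻ : occursAtHead σ231 (x ∷ y ∷ z ∷ R) ≡ true → z < x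
  occursAtHead-231⁻ {x} {y} {z} occurs with x <ᵇ y | y <ᵇ x | x <ᵇ z | z <ᵇ x in z<ᵇx
  ... | _ | _ | _ | true = <ᵇ-true⁻ z<ᵇx
  ... | false | _ | _ | false = contradiction occurs λ ()
  ... | true | true | _ | false = contradiction occurs λ ()
  ... | true | false | true | false = contradiction occurs λ ()
  ... | true | false | false | false = contradiction occurs λ ()

  ¬occursAtHead-231 : z < x → occursAtHead σ231 (x ∷ z ∷ R) ≡ false
  ¬occursAtHead-231 {z} {x} {[]} _ = occursAtHead-short σ231 {x ∷ z ∷ []} ≤-refl
  ¬occursAtHead-231 {z} {x} {R = _ ∷ _} z<x rewrite <ᵇ-false {x} {z} z<x = refl

  admissible-213 : Admissible σ213
  admissible-213 = record { singlePop = single-pop ; longerThanTwo = ≤-refl }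
    where
    single-pop : SinglePop σ213
    single-pop x t [] occurs = contradiction (trans (sym occurs) (occursAtHead-short σ213 {x ∷ t ∷ []} ≤-refl)) λ ()
    single-pop x t (z ∷ R) occurs = ¬occursAtHead-213 {R = R} (occursAtHead-213⁻ {x} {t} {z} {R} occurs)

  admissible-231 : Admissible σ231
  admissible-231 = record { singlePop = single-pop ; longerThanTwo = ≤-refl }
    where
    single-pop : SinglePop σ231
    single-pop x t [] occurs = contradiction (trans (sym occurs) (occursAtHead-short σ231 {x ∷ t ∷ []} ≤-refl)) λ ()
    single-pop x t (z ∷ R) occurs = ¬occursAtHead-231 {R = R} (occursAtHead-231⁻ {x} {t} {z} {R} occurs)

ascending descending : ℕ → ℕ → List ℕ
ascending zero lo = [ lo ]
ascending (suc k) lo = lo ∷ ascending k (suc lo)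
descending zero lo = [ lo ]
descending (suc k) lo = (lo + suc k) ∷ descending k lo

ascending-++ : ∀ k lo R → ascending k lo ++ (lo + suc k) ∷ R ≡ ascending (suc k) lo ++ R
ascending-++ zero lo R = cong (λ m → lo ∷ m ∷ R) (+-comm lo 1)
ascending-++ (suc k) lo R =
  cong (lo ∷_) (trans (cong (λ m → ascending k (suc lo) ++ m ∷ R) (+-suc lo (suc k))) (ascending-++ k (suc lo) R))

descending-++ : ∀ k lo R → descending k (suc lo) ++ lo ∷ R ≡ descending (suc k) lo ++ R
descending-++ zero lo R = cong (λ m → m ∷ lo ∷ R) (+-comm 1 lo)
descending-++ (suc k) lo R = cong₂ _∷_ (sym (+-suc lo (suc k))) (descending-++ k lo R)

applyUpTo-ascending : ∀ k lo (f : ℕ → ℕ) → (∀ i → f i ≡ lo + i) → applyUpTo f (suc k) ≡ ascending k lo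
applyUpTo-ascending zero lo f f≗ = cong [_] (trans (f≗ 0) (+-identityʳ lo))
applyUpTo-ascending (suc k) lo f f≗ =
  cong₂ _∷_ (trans (f≗ 0) (+-identityʳ lo))
    (applyUpTo-ascending k (suc lo) (λ i → f (suc i)) (λ i → trans (f≗ (suc i)) (+-suc lo i)))

range≡ascending : ∀ k → range (suc k) ≡ ascending k 1
range≡ascending k = trans (map-upTo suc (suc k)) (applyUpTo-ascending k 1 suc (λ _ → refl))

∷-ascending↭ : ∀ k lo → (lo + suc k) ∷ ascending k lo ↭ ascending (suc k) lo
∷-ascending↭ k lo = ↭-trans (∷↭∷ʳ _ (ascending k lo)) (↭-reflexive (trans (ascending-++ k lo []) (++-identityʳ _)))

descending↭ascending : ∀ k lo → descending k lo ↭ ascending k lo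
descending↭ascending zero lo = ↭-refl
descending↭ascending (suc k) lo = ↭-trans (↭-prep _ (descending↭ascending k lo)) (∷-ascending↭ k lo)

minMax : List Bool → ℕ → List ℕ
minMax [] lo = [ lo ]
minMax (true ∷ b) lo = lo ∷ minMax b (suc lo)
minMax (false ∷ b) lo = (lo + suc (length b)) ∷ minMax b lo

minMax↭ascending : ∀ b lo → minMax b lo ↭ ascending (length b) lo
minMax↭ascending [] lo = ↭-refl
minMax↭ascending (true ∷ b) lo = ↭-prep lo (minMax↭ascending b (suc lo))
minMax↭ascending (false ∷ b) lo = ↭-trans (↭-prep _ (minMax↭ascending b lo)) (∷-ascending↭ (length b) lo)

containsConsec-213-∷⁺ : x < z → containsConsec σ213 (z ∷ R) ≡ false → containsConsec σ213 (x ∷ z ∷ R) ≡ false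
containsConsec-213-∷⁺ x<z = containsConsec-∷⁺ σ213 (¬occursAtHead-213 x<z)

push-213 : x < z → containsConsec σ213 (z ∷ R) ≡ false →
  trace σ213 (x ∷ inp) (z ∷ R) ≡ false ∷ trace σ213 inp (x ∷ z ∷ R)
push-213 {x} {z} {R} {inp} x<z free = trace-push {σ213} {x} {z ∷ R} {inp} (cong not (containsConsec-213-∷⁺ x<z free))

pop-213 : y < x → x < z → trace σ213 (x ∷ inp) (y ∷ z ∷ R) ≡ true ∷ trace σ213 inp (x ∷ z ∷ R)
pop-213 {y} {x} {z} {inp} {R} y<x x<z =
  trace-pop {σ213} {x} {y} {z ∷ R} {inp} (cong not (occursAtHead⇒containsConsec σ213 (occursAtHead-213 y<x x<z)))

+0-< : lo + 0 < z → lo < z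
+0-< {lo} {z} = subst (_< z) (+-identityʳ lo)

+suc-< : lo + suc k < z → suc lo + k < z
+suc-< {lo} {k} {z} = subst (_< z) (+-suc lo k)

<-+suc : ∀ lo k → lo + k < lo + suc k
<-+suc lo k = +-monoʳ-< lo (n<1+n k)

-- While 213 sorts minMax b lo, the stack holds entries above lo + length b, possibly topped by one
-- entry below lo; the next entry pops such a low top and is otherwise pushed.
trace-213-low : ∀ b lo {y z R} → y < lo → lo + length b < z → containsConsec σ213 (z ∷ R) ≡ false →
  trace σ213 (minMax b lo) (y ∷ z ∷ R) ≡ true ∷ b
trace-213-high : ∀ b lo {z R} → lo + length b < z → containsConsec σ213 (z ∷ R) ≡ false →
  trace σ213 (minMax b lo) (z ∷ R) ≡ false ∷ b

trace-213-low [] lo y<lo lo<z _ = pop-213 {inp = []} y<lo (+0-< lo<z)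
trace-213-low (true ∷ b) lo y<lo top<z free =
  trans (pop-213 {inp = minMax b (suc lo)} y<lo (≤-<-trans (m≤m+n lo _) top<z))
    (cong (true ∷_) (trace-213-low b (suc lo) (n<1+n lo) (+suc-< top<z) free))
trace-213-low (false ∷ b) lo y<lo top<z free =
  trans (pop-213 {inp = minMax b lo} (<-≤-trans y<lo (m≤m+n lo _)) top<z)
    (cong (true ∷_) (trace-213-high b lo (<-+suc lo (length b)) (containsConsec-213-∷⁺ top<z free)))

trace-213-high [] lo lo<z free = push-213 {inp = []} (+0-< lo<z) free
trace-213-high (true ∷ b) lo top<z free =
  trans (push-213 {inp = minMax b (suc lo)} (≤-<-trans (m≤m+n lo _) top<z) free)
    (cong (false ∷_) (trace-213-low b (suc lo) (n<1+n lo) (+suc-< top<z) free))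
trace-213-high (false ∷ b) lo top<z free =
  trans (push-213 {inp = minMax b lo} top<z free)
    (cong (false ∷_) (trace-213-high b lo (<-+suc lo (length b)) (containsConsec-213-∷⁺ top<z free)))

containsConsec-231-∷⁺ : z < x → containsConsec σ231 (z ∷ R) ≡ false → containsConsec σ231 (x ∷ z ∷ R) ≡ false
containsConsec-231-∷⁺ z<x = containsConsec-∷⁺ σ231 (¬occursAtHead-231 z<x)

push-231 : z < x → containsConsec σ231 (z ∷ R) ≡ false →
  trace σ231 (x ∷ inp) (z ∷ R) ≡ false ∷ trace σ231 inp (x ∷ z ∷ R)
push-231 {z} {x} {R} {inp} z<x free = trace-push {σ231} {x} {z ∷ R} {inp} (cong not (containsConsec-231-∷⁺ z<x free))

pop-231 : z < x → x < y → trace σ231 (x ∷ inp) (y ∷ z ∷ R) ≡ true ∷ trace σ231 inp (x ∷ z ∷ R)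
pop-231 {z} {x} {y} {inp} {R} z<x x<y =
  trace-pop {σ231} {x} {y} {z ∷ R} {inp} (cong not (occursAtHead⇒containsConsec σ231 (occursAtHead-231 z<x x<y)))

-- For 231 the roles are mirrored: the stack holds entries below lo, possibly topped by one entry
-- above lo + length c, and the trace records the complemented bits.
trace-231-high : ∀ c lo {y z R} → lo + length c < y → z < lo → containsConsec σ231 (z ∷ R) ≡ false →
  trace σ231 (minMax c lo) (y ∷ z ∷ R) ≡ true ∷ map not c
trace-231-low : ∀ c lo {z R} → z < lo → containsConsec σ231 (z ∷ R) ≡ false →
  trace σ231 (minMax c lo) (z ∷ R) ≡ false ∷ map not c

trace-231-high [] lo lo<y z<lo _ = pop-231 {inp = []} z<lo (+0-< lo<y)
trace-231-high (true ∷ c) lo top<y z<lo free =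
  trans (pop-231 {inp = minMax c (suc lo)} z<lo (≤-<-trans (m≤m+n lo _) top<y))
    (cong (true ∷_) (trace-231-low c (suc lo) (n<1+n lo) (containsConsec-231-∷⁺ z<lo free)))
trace-231-high (false ∷ c) lo top<y z<lo free =
  trans (pop-231 {inp = minMax c lo} (<-≤-trans z<lo (m≤m+n lo _)) top<y)
    (cong (true ∷_) (trace-231-high c lo (<-+suc lo (length c)) z<lo free))

trace-231-low [] lo z<lo free = push-231 {inp = []} z<lo free
trace-231-low (true ∷ c) lo z<lo free =
  trans (push-231 {inp = minMax c (suc lo)} z<lo free)
    (cong (false ∷_) (trace-231-low c (suc lo) (n<1+n lo) (containsConsec-231-∷⁺ z<lo free)))
trace-231-low (false ∷ c) lo z<lo free =
  trans (push-231 {inp = minMax c lo} (<-≤-trans z<lo (m≤m+n lo _)) free)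
    (cong (false ∷_) (trace-231-high c lo (<-+suc lo (length c)) z<lo free))

replay-true-minMax : ∀ b lo x R → replay (true ∷ b) (minMax b lo) (x ∷ R) ≡ x ∷ (ascending (length b) lo ++ R)
replay-false-minMax : ∀ b lo R → replay (false ∷ b) (minMax b lo) R ≡ ascending (length b) lo ++ R

replay-true-minMax [] lo x R = refl
replay-true-minMax (true ∷ b) lo x R = cong (x ∷_) (replay-true-minMax b (suc lo) lo R)
replay-true-minMax (false ∷ b) lo x R = cong (x ∷_) (replay-false-minMax (false ∷ b) lo R)

replay-false-minMax [] lo R = refl
replay-false-minMax (true ∷ b) lo R = replay-true-minMax b (suc lo) lo R
replay-false-minMax (false ∷ b) lo R =
  trans (replay-false-minMax b lo ((lo + suc (length b)) ∷ R)) (ascending-++ (length b) lo R)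

replay-true-minMax-not : ∀ c lo x R → replay (true ∷ map not c) (minMax c lo) (x ∷ R) ≡ x ∷ (descending (length c) lo ++ R)
replay-false-minMax-not : ∀ c lo R → replay (false ∷ map not c) (minMax c lo) R ≡ descending (length c) lo ++ R

replay-true-minMax-not [] lo x R = refl
replay-true-minMax-not (true ∷ c) lo x R = cong (x ∷_) (replay-false-minMax-not (true ∷ c) lo R)
replay-true-minMax-not (false ∷ c) lo x R = cong (x ∷_) (replay-true-minMax-not c lo (lo + suc (length c)) R)

replay-false-minMax-not [] lo R = refl
replay-false-minMax-not (true ∷ c) lo R =
  trans (replay-false-minMax-not c (suc lo) (lo ∷ R)) (descending-++ (length c) lo R)
replay-false-minMax-not (false ∷ c) lo R = replay-true-minMax-not c lo (lo + suc (length c)) R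

map-not-involutive : ∀ b → map not (map not b) ≡ b
map-not-involutive [] = refl
map-not-involutive (x ∷ b) = cong₂ _∷_ (not-involutive x) (map-not-involutive b)

ascending-isPerm : ∀ k → IsPerm (2 + k) (ascending (suc k) 1)
ascending-isPerm k = ↭-reflexive (sym (range≡ascending (suc k)))

descending-isPerm : ∀ k → IsPerm (2 + k) (descending (suc k) 1)
descending-isPerm k = ↭-trans (descending↭ascending (suc k) 1) (ascending-isPerm k)

preimage-213 : List Bool → List ℕ
preimage-213 b = suc (suc (length b)) ∷ minMax b 1

preimage-213-isPerm : ∀ b → IsPerm (2 + length b) (preimage-213 b)
preimage-213-isPerm b =
  ↭-trans (↭-prep _ (minMax↭ascending b 1)) (↭-trans (∷-ascending↭ (length b) 1) (ascending-isPerm (length b)))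

trace-preimage-213 : ∀ b → trace σ213 (preimage-213 b) [] ≡ pushPush b
trace-preimage-213 b =
  trans (trace-push {σ213} {N} {[]} {minMax b 1} (cong not N-free))
    (cong (false ∷_) (trace-213-high b 1 {N} {[]} ≤-refl N-free))
  where
  N : ℕ
  N = suc (suc (length b))
  N-free : containsConsec σ213 [ N ] ≡ false
  N-free = short-avoids {σ213} {[ N ]} admissible-213 (s≤s z≤n)

SC-preimage-213 : ∀ b → SC σ213 (preimage-213 b) ≡ ascending (suc (length b)) 1
SC-preimage-213 b = begin
  SC σ213 (preimage-213 b)                                    ≡⟨ SC-replay admissible-213 (preimage-213 b) ⟩
  replay (trace σ213 (preimage-213 b) []) (preimage-213 b) [] ≡⟨ cong (λ bs → replay bs (preimage-213 b) []) (trace-preimage-213 b) ⟩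
  replay (false ∷ b) (minMax b 1) [ suc (suc (length b)) ]    ≡⟨ replay-false-minMax b 1 _ ⟩
  ascending (length b) 1 ++ [ suc (suc (length b)) ]          ≡⟨ ascending-++ (length b) 1 [] ⟩
  ascending (suc (length b)) 1 ++ []                          ≡⟨ ++-identityʳ _ ⟩
  ascending (suc (length b)) 1                                ∎
  where open ≡-Reasoning

fibre-card-213 : ∀ k → HasCard (Fibre σ213 (2 + k) (ascending (suc k) 1)) (2 ^ k)
fibre-card-213 k = fibre-card-of-preimages admissible-213 preimage-213 trace-preimage-213 in-fibre
  where
  in-fibre : ∀ b → length b ≡ k → Fibre σ213 (2 + k) (ascending (suc k) 1) (preimage-213 b)
  in-fibre b refl = preimage-213-isPerm b , SC-preimage-213 b

preimage-231 : List Bool → List ℕ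
preimage-231 b = 1 ∷ minMax (map not b) 2

preimage-231-isPerm : ∀ b → IsPerm (2 + length b) (preimage-231 b)
preimage-231-isPerm b = subst (λ m → IsPerm (2 + m) (preimage-231 b)) (length-map not b)
  (↭-trans (↭-prep 1 (minMax↭ascending (map not b) 2)) (ascending-isPerm (length (map not b))))

trace-preimage-231 : ∀ b → trace σ231 (preimage-231 b) [] ≡ pushPush b
trace-preimage-231 b =
  trans (trace-push {σ231} {1} {[]} {minMax (map not b) 2} (cong not one-free))
    (cong (false ∷_) (trans (trace-231-low (map not b) 2 {1} {[]} ≤-refl one-free)
                            (cong (false ∷_) (map-not-involutive b))))
  where
  one-free : containsConsec σ231 [ 1 ] ≡ false
  one-free = short-avoids {σ231} {[ 1 ]} admissible-231 (s≤s z≤n)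

SC-preimage-231 : ∀ b → SC σ231 (preimage-231 b) ≡ descending (suc (length b)) 1
SC-preimage-231 b = begin
  SC σ231 (preimage-231 b)                                    ≡⟨ SC-replay admissible-231 (preimage-231 b) ⟩
  replay (trace σ231 (preimage-231 b) []) (preimage-231 b) [] ≡⟨ cong (λ bs → replay bs (preimage-231 b) []) (trace-preimage-231 b) ⟩
  replay (false ∷ b) (minMax c 2) [ 1 ]                       ≡⟨ cong (λ b′ → replay (false ∷ b′) (minMax c 2) [ 1 ]) (map-not-involutive b) ⟨
  replay (false ∷ map not c) (minMax c 2) [ 1 ]               ≡⟨ replay-false-minMax-not c 2 [ 1 ] ⟩
  descending (length c) 2 ++ [ 1 ]                            ≡⟨ descending-++ (length c) 1 [] ⟩
  descending (suc (length c)) 1 ++ []                         ≡⟨ ++-identityʳ _ ⟩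
  descending (suc (length c)) 1                               ≡⟨ cong (λ m → descending (suc m) 1) (length-map not b) ⟩
  descending (suc (length b)) 1                               ∎
  where
  open ≡-Reasoning
  c : List Bool
  c = map not b

fibre-card-231 : ∀ k → HasCard (Fibre σ231 (2 + k) (descending (suc k) 1)) (2 ^ k)
fibre-card-231 k = fibre-card-of-preimages admissible-231 preimage-231 trace-preimage-231 in-fibre
  where
  in-fibre : ∀ b → length b ≡ k → Fibre σ231 (2 + k) (descending (suc k) 1) (preimage-231 b)
  in-fibre b refl = preimage-231-isPerm b , SC-preimage-231 b

theorem5p2 : (n : ℕ) → 2 ≤ n →
    ((σ : List ℕ) → (σ ≡ 2 ∷ 1 ∷ 3 ∷ []) ⊎ (σ ≡ 2 ∷ 3 ∷ 1 ∷ []) →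
      ((π : List ℕ) → IsPerm n π → (k : ℕ) → HasCard (Fibre σ n π) k → k ≤ 2 ^ (n ∸ 2))
      × Σ (List ℕ) (λ π → IsPerm n π × HasCard (Fibre σ n π) (2 ^ (n ∸ 2))))
theorem5p2 (suc (suc k)) (s≤s (s≤s z≤n)) σ (inj₁ refl) rewrite sym σ213-def =
  (λ π _ → fibre-card-≤ admissible-213 k π) , ascending (suc k) 1 , ascending-isPerm k , fibre-card-213 k
theorem5p2 (suc (suc k)) (s≤s (s≤s z≤n)) σ (inj₂ refl) rewrite sym σ231-def =
  (λ π _ → fibre-card-≤ admissible-231 k π) , descending (suc k) 1 , descending-isPerm k , fibre-card-231 k
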